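{- \[ ex(n;P_3;2) = (n/2)^{3} + O(n^2). \]
   Context: A digraph has a vertex set and an arc set consisting of ordered pairs of distinct vertices. A walk of length $\ell$ is a sequence $x_0x_1\dots x_\ell$ of vertices with $x_i \rightarrow x_{i+1}$ for all $i$. A digraph is $k$-geodetic if for every ordered pair $(u,v)$ of (not necessarily distinct) vertices there is at most one $u,v$-walk of length at most $k$. $P_3$ denotes the directed path of length $3$ (three arcs, four distinct vertices). For a digraph $Z$ and $k\ge 2$, $ex(n;Z;k)$ is the largest number of copies of $Z$ (subdigraphs isomorphic to $Z$) in a $k$-geodetic digraph with $n$ vertices. -}

module Defs where

open import Data.Nat using (ℕ; zero; suc; _+_; _≤_)
open import Data.Bool using (Bool; true; false; _∧_; not; if_then_else_; T)
open import Data.Fin using (Fin; _≟_)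
open import Data.List using (List; map; allFin)
open import Data.Nat.ListAction using (sum)
open import Data.Product using (Σ; _,_)
open import Relation.Nullary.Decidable using (⌊_⌋)
open import Relation.Binary.PropositionalEquality using (_≡_)

record Digraph (n : ℕ) : Set where
  field
    arc    : Fin n → Fin n → Bool
    irrefl : ∀ x → arc x x ≡ false

open Digraph public

Arc : ∀ {n} → Digraph n → Fin n → Fin n → Set
Arc G u v = T (arc G u v)

data Walk {n : ℕ} (G : Digraph n) : Fin n → Fin n → ℕ → Set where
  nil  : ∀ u → Walk G u u zero
  cons : ∀ {u w v ℓ} → Arc G u w → Walk G w v ℓ → Walk G u v (suc ℓ)

Geodetic : ∀ {n} → ℕ → Digraph n → Set
Geodetic {n} k G =
  ∀ (u v : Fin n) (ℓ₁ ℓ₂ : ℕ) (p : Walk G u v ℓ₁) (q : Walk G u v ℓ₂) →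
  ℓ₁ ≤ k → ℓ₂ ≤ k →
  _≡_ {A = Σ ℕ (Walk G u v)} (ℓ₁ , p) (ℓ₂ , q)

sumFin : (n : ℕ) → (Fin n → ℕ) → ℕ
sumFin n f = sum (map f (allFin n))

neq : ∀ {n} → Fin n → Fin n → Bool
neq a b = not ⌊ a ≟ b ⌋

isP3 : ∀ {n} → Digraph n → Fin n → Fin n → Fin n → Fin n → Bool
isP3 G a b c d =
  neq a b ∧ neq a c ∧ neq a d ∧ neq b c ∧ neq b d ∧ neq c d ∧
  arc G a b ∧ arc G b c ∧ arc G c d

-- Number of copies of P₃ in G.  Since P₃ has trivial automorphism group,
-- copies (subdigraphs isomorphic to P₃) correspond bijectively to the
-- vertex sequences (a,b,c,d) above.
countP3 : ∀ {n} → Digraph n → ℕ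
countP3 {n} G =
  sumFin n λ a → sumFin n λ b → sumFin n λ c → sumFin n λ d →
    if isP3 G a b c d then 1 else 0

-- Let A be the adjacency matrix of a 2-geodetic digraph on n vertices, so A + A² is a 0/1 matrix.
-- Every copy of P₃ is a walk of length 3, and these walks number Σᵥ xᵥ sᵥ = Σᵥ yᵥ rᵥ, where xᵥ, yᵥ
-- are the in- and out-degree of v and sᵥ, rᵥ the number of walks of length 2 leaving and entering v.
-- Geodecity gives s + y ≤ n and s + x ≤ n + y at every vertex, and the same inequalities for the
-- transpose, with (x, s) and (y, r) exchanged; together they force 4(xs + yr) ≤ n² + 12xy. Summing
-- over v and using Σᵥ xᵥ yᵥ ≤ n² (a walk of length 2 is determined by its ends) gives
-- 8 #P₃ ≤ n³ + 12n². For the lower bound, with k = ⌊n/2⌋ join i → j + k for i ≠ j and j + k → j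
-- (i, j < k). This digraph is 2-geodetic and bipartite, so its walks of length 3 are copies of P₃,
-- and at least k(k − 1)² of them have the form i → j + k → j → l + k.

module Submission where

open import Defs
open import Data.Nat using (ℕ; _+_; _*_; _^_; _≤_)
open import Data.Product using (Σ; _×_; _,_; proj₁)

open import Data.Bool using (Bool; true; false; T; _∧_; not; if_then_else_)
open import Data.Bool.Properties using (T-∧; T-irrelevant)
open import Data.Empty using (⊥; ⊥-elim)
open import Data.Fin using (Fin; zero; suc; toℕ; fromℕ<)
import Data.Fin.Properties as Fin
open import Data.List using (map; tabulate; _∷_; [])
import Data.Nat.ListAction as List
open import Data.Nat using (zero; suc; _∸_; _<_; z≤n; s≤s; z<s; _≤?_; _<?_; ⌊_/2⌋; ⌈_/2⌉)
open import Data.Nat.Properties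
open import Data.Sum using (_⊎_; inj₁; inj₂; [_,_]′)
open import Data.Nat.Tactic.RingSolver using (solve; solve-∀)
open import Data.Nat.Solver using (module +-*-Solver)
open import Function using (_∘_; _$_)
open import Function.Bundles using (Equivalence)
open import Relation.Binary.PropositionalEquality
open import Relation.Nullary using (¬_; Dec; yes; no)
open import Relation.Nullary.Decidable using (⌊_⌋; toWitness; fromWitness; fromWitnessFalse; _×-dec_; _⊎-dec_; ¬?)

open import Algebra.Properties.CommutativeSemigroup *-commutativeSemigroup using (x∙yz≈z∙yx; x∙yz≈y∙zx)
open import Algebra.Properties.Semiring.Sum +-*-semiring
  using (sum-syntax; ∑-distrib-+; ∑-comm; *-distribˡ-sum; *-distribʳ-sum; sum-cong-≗; sum-remove)

𝟙 : Bool → ℕ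
𝟙 b = if b then 1 else 0

𝟙≤1 : ∀ b → 𝟙 b ≤ 1
𝟙≤1 true  = ≤-refl
𝟙≤1 false = z≤n

𝟙-mono : ∀ {x y} → (T x → T y) → 𝟙 x ≤ 𝟙 y
𝟙-mono {false} _ = z≤n
𝟙-mono {true} {true} _ = ≤-refl
𝟙-mono {true} {false} x⇒y = ⊥-elim (x⇒y _)

𝟙-∧ : ∀ x y → 𝟙 (x ∧ y) ≡ 𝟙 x * 𝟙 y
𝟙-∧ true  y = sym (+-identityʳ (𝟙 y))
𝟙-∧ false y = refl

𝟙≡1⇒T : ∀ {b} → 𝟙 b ≡ 1 → T b
𝟙≡1⇒T {true} _ = _

T⇒1≤𝟙 : ∀ {b} → T b → 1 ≤ 𝟙 b
T⇒1≤𝟙 {true} _ = ≤-refl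

sum-map-tabulate : ∀ {A : Set} n (g : Fin n → A) (f : A → ℕ) →
                   List.sum (map f (tabulate g)) ≡ ∑[ i < n ] f (g i)
sum-map-tabulate zero    g f = refl
sum-map-tabulate (suc n) g f = cong (f (g zero) +_) (sum-map-tabulate n (g ∘ suc) f)

sumFin≡∑ : ∀ n (f : Fin n → ℕ) → sumFin n f ≡ ∑[ i < n ] f i
sumFin≡∑ n f = sum-map-tabulate n (λ i → i) f

∑-mono-≤ : ∀ {n} {f g : Fin n → ℕ} → (∀ i → f i ≤ g i) → ∑[ i < n ] f i ≤ ∑[ i < n ] g i
∑-mono-≤ {zero}  _   = z≤n
∑-mono-≤ {suc n} f≤g = +-mono-≤ (f≤g zero) (∑-mono-≤ (f≤g ∘ suc))

∑-const : ∀ n c → ∑[ i < n ] c ≡ n * c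
∑-const zero    c = refl
∑-const (suc n) c = cong (c +_) (∑-const n c)

∑-ones : ∀ n → ∑[ i < n ] 1 ≡ n
∑-ones n = trans (∑-const n 1) (*-identityʳ n)

term≤∑ : ∀ {n} (f : Fin n → ℕ) i → f i ≤ ∑[ j < n ] f j
term≤∑ {suc n} f i = ≤-trans (m≤m+n (f i) _) (≤-reflexive (sym (sum-remove {i = i} f)))

∑-≤1 : ∀ {n} (f : Fin n → ℕ) → (∀ i → f i ≤ 1) → (∀ i j → f i ≡ 1 → f j ≡ 1 → i ≡ j) →
       ∑[ i < n ] f i ≤ 1
∑-≤1 {zero}  f _   _      = z≤n
∑-≤1 {suc n} f f≤1 unique with f zero | f≤1 zero | unique zero
... | 0 | _       | _       = ∑-≤1 (f ∘ suc) (f≤1 ∘ suc) (λ i j p q → Fin.suc-injective (unique (suc i) (suc j) p q))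
... | suc (suc _) | s≤s () | _
... | 1 | _       | unique₀ = s≤s (≤-reflexive (trans (sum-cong-≗ tail≡0) (trans (∑-const n 0) (*-zeroʳ n))))
  where
  tail≡0 : ∀ i → f (suc i) ≡ 0
  tail≡0 i with f (suc i) | f≤1 (suc i) | unique₀ (suc i)
  ... | 0 | _ | _ = refl
  ... | 1 | _ | zero≡suc with () ← zero≡suc refl refl
  ... | suc (suc _) | s≤s () | _

∑-interval : ∀ {n} (f : Fin n → ℕ) lo t m → lo + t ≤ n →
             (∀ i → lo ≤ toℕ i → toℕ i < lo + t → m ≤ f i) → t * m ≤ ∑[ i < n ] f i
∑-interval f lo zero m _ _ = z≤n
∑-interval {zero} f lo (suc t) m h _ with () ← ≤-trans (m≤n+m (suc t) lo) h
∑-interval {suc n} f zero (suc t) m (s≤s h) low =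
  +-mono-≤ (low zero z≤n z<s) (∑-interval (f ∘ suc) zero t m h (λ i _ i<t → low (suc i) z≤n (s≤s i<t)))
∑-interval {suc n} f (suc lo) t m (s≤s h) low =
  ≤-trans (∑-interval (f ∘ suc) lo t m h (λ i lo≤i i<lo+t → low (suc i) (s≤s lo≤i) (s≤s i<lo+t)))
          (m≤n+m _ (f zero))

∑-interval-except : ∀ {n} (f : Fin n → ℕ) lo t x → lo + t ≤ n →
                    (∀ i → lo ≤ toℕ i → toℕ i < lo + t → toℕ i ≢ x → 1 ≤ f i) →
                    t ∸ 1 ≤ ∑[ i < n ] f i
∑-interval-except {n} f lo t x lo+t≤n low = m≤n+o⇒m∸n≤o t 1 (begin
  t                                        ≡⟨ *-identityʳ t ⟨
  t * 1                                    ≤⟨ ∑-interval (λ i → hit i + f i) lo t 1 lo+t≤n low′ ⟩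
  ∑[ i < n ] (hit i + f i)                 ≡⟨ ∑-distrib-+ hit f ⟩
  ∑[ i < n ] hit i + ∑[ i < n ] f i        ≤⟨ +-monoˡ-≤ _ (∑-≤1 hit (𝟙≤1 ∘ is-x) hit-unique) ⟩
  1 + ∑[ i < n ] f i                       ∎)
  where
  open ≤-Reasoning
  is-x : Fin n → Bool
  is-x i = ⌊ toℕ i ≟ x ⌋
  hit : Fin n → ℕ
  hit = 𝟙 ∘ is-x
  hit-unique : ∀ i j → hit i ≡ 1 → hit j ≡ 1 → i ≡ j
  hit-unique i j p q = Fin.toℕ-injective (trans (toWitness (𝟙≡1⇒T p)) (sym (toWitness (𝟙≡1⇒T q))))
  low′ : ∀ i → lo ≤ toℕ i → toℕ i < lo + t → 1 ≤ hit i + f i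
  low′ i lo≤i i<lo+t with toℕ i ≟ x
  ... | yes _  = s≤s z≤n
  ... | no i≢x = low i lo≤i i<lo+t i≢x

+≤1+* : ∀ {a b} → a ≤ 1 → b ≤ 1 → a + b ≤ 1 + b * a
+≤1+* z≤n       z≤n       = z≤n
+≤1+* z≤n       (s≤s z≤n) = ≤-refl
+≤1+* (s≤s z≤n) z≤n       = ≤-refl
+≤1+* (s≤s z≤n) (s≤s z≤n) = ≤-refl

*≤1⇒≤ : ∀ a {b} → b ≤ 1 → a * b ≤ a
*≤1⇒≤ a b≤1 = ≤-trans (*-monoʳ-≤ a b≤1) (≤-reflexive (*-identityʳ a))

2ab≤a²+b² : ∀ a b → 2 * (a * b) ≤ a * a + b * b
2ab≤a²+b² a b = [ ordered , (λ b≤a → subst₂ _≤_ (cong (2 *_) (*-comm b a)) (+-comm (b * b) (a * a)) (ordered b≤a)) ]′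
                (≤-total a b)
  where
  ordered : ∀ {a b} → a ≤ b → 2 * (a * b) ≤ a * a + b * b
  ordered {a} a≤b with d , refl ← m≤n⇒∃[o]m+o≡n a≤b = begin
    2 * (a * (a + d))          ≤⟨ m≤m+n _ (d * d) ⟩
    2 * (a * (a + d)) + d * d  ≡⟨ solve (a ∷ d ∷ []) ⟩
    a * a + (a + d) * (a + d)  ∎
    where open ≤-Reasoning

-- The two hypotheses give xs + yr + x² ≤ (x + y)n, and 4(x + y)n ≤ n² + 4(x + y)² by AM-GM.
vertex-bound-≤ : ∀ {n x y s r} → y ≤ x → s + x ≤ n + y → r + x ≤ n →
                 4 * (x * s + y * r) ≤ n * n + 12 * (x * y)
vertex-bound-≤ {n} {x} {y} {s} {r} y≤x s+x≤n+y r+x≤n = +-cancelʳ-≤ (4 * (x * x) + 4 * (x * y)) _ _ (begin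
  4 * (x * s + y * r) + (4 * (x * x) + 4 * (x * y))  ≡⟨ solve (x ∷ y ∷ s ∷ r ∷ []) ⟩
  4 * (x * (s + x) + y * (r + x))                    ≤⟨ *-monoʳ-≤ 4 (+-mono-≤ (*-monoʳ-≤ x s+x≤n+y) (*-monoʳ-≤ y r+x≤n)) ⟩
  4 * (x * (n + y) + y * n)                          ≡⟨ solve (n ∷ x ∷ y ∷ []) ⟩
  2 * (2 * (x + y) * n) + 4 * (x * y)                ≤⟨ +-monoˡ-≤ _ (2ab≤a²+b² (2 * (x + y)) n) ⟩
  2 * (x + y) * (2 * (x + y)) + n * n + 4 * (x * y)  ≡⟨ solve (n ∷ x ∷ y ∷ []) ⟩
  n * n + 4 * (x * x) + 12 * (x * y) + 4 * (y * y)   ≤⟨ +-monoʳ-≤ (n * n + 4 * (x * x) + 12 * (x * y)) (*-monoʳ-≤ 4 (*-monoˡ-≤ y y≤x)) ⟩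
  n * n + 4 * (x * x) + 12 * (x * y) + 4 * (x * y)   ≡⟨ solve (n ∷ x ∷ y ∷ []) ⟩
  n * n + 12 * (x * y) + (4 * (x * x) + 4 * (x * y)) ∎)
  where open ≤-Reasoning

vertex-bound : ∀ {n x y s r} → s + y ≤ n → s + x ≤ n + y → r + x ≤ n → r + y ≤ n + x →
               4 * (x * s + y * r) ≤ n * n + 12 * (x * y)
vertex-bound {n} {x} {y} {s} {r} s+y≤n s+x≤n+y r+x≤n r+y≤n+x with ≤-total y x
... | inj₁ y≤x = vertex-bound-≤ y≤x s+x≤n+y r+x≤n
... | inj₂ x≤y = subst₂ _≤_ (cong (4 *_) (+-comm (y * r) (x * s))) (cong (λ t → n * n + 12 * t) (*-comm y x))
                        (vertex-bound-≤ x≤y r+y≤n+x s+y≤n)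

-- Walks in a matrix A with A + A² ≤ 1 entrywise

Matrix : ℕ → Set
Matrix n = Fin n → Fin n → ℕ

module _ {n : ℕ} where

  _ᵀ : Matrix n → Matrix n
  (A ᵀ) u v = A v u

  _² : Matrix n → Matrix n
  (A ²) u w = ∑[ c < n ] (A u c * A c w)

  indeg outdeg : Matrix n → Fin n → ℕ
  indeg  A v = ∑[ u < n ] A u v
  outdeg A v = ∑[ w < n ] A v w

  walks₃ : Matrix n → ℕ
  walks₃ A = ∑[ a < n ] ∑[ b < n ] ∑[ c < n ] ∑[ d < n ] (A a b * (A b c * A c d))

  ²-ᵀ : ∀ A u w → ((A ᵀ) ²) u w ≡ (A ²) w u
  ²-ᵀ A u w = sum-cong-≗ (λ c → *-comm (A c u) (A w c))

  outdeg-² : ∀ A v → outdeg (A ²) v ≡ ∑[ c < n ] (A v c * outdeg A c)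
  outdeg-² A v = trans (∑-comm (λ w c → A v c * A c w)) (sum-cong-≗ (λ c → sym (*-distribˡ-sum (A v c) (A c))))

  walks₃-middle : ∀ A → walks₃ A ≡ ∑[ b < n ] ∑[ c < n ] (indeg A b * (A b c * outdeg A c))
  walks₃-middle A = begin
    walks₃ A
      ≡⟨ sum-cong-≗ (λ a → sum-cong-≗ (λ b → sum-cong-≗ (λ c → sym (pull-out a b c)))) ⟩
    ∑[ a < n ] ∑[ b < n ] ∑[ c < n ] (A a b * (A b c * outdeg A c))
      ≡⟨ ∑-comm (λ a b → ∑[ c < n ] (A a b * (A b c * outdeg A c))) ⟩
    ∑[ b < n ] ∑[ a < n ] ∑[ c < n ] (A a b * (A b c * outdeg A c))
      ≡⟨ sum-cong-≗ (λ b → ∑-comm (λ a c → A a b * (A b c * outdeg A c))) ⟩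
    ∑[ b < n ] ∑[ c < n ] ∑[ a < n ] (A a b * (A b c * outdeg A c))
      ≡⟨ sum-cong-≗ (λ b → sum-cong-≗ (λ c → *-distribʳ-sum (A b c * outdeg A c) (λ a → A a b))) ⟨
    ∑[ b < n ] ∑[ c < n ] (indeg A b * (A b c * outdeg A c))
      ∎
    where
    open ≡-Reasoning
    pull-out : ∀ a b c → A a b * (A b c * outdeg A c) ≡ ∑[ d < n ] (A a b * (A b c * A c d))
    pull-out a b c = trans (cong (A a b *_) (*-distribˡ-sum (A b c) (A c))) (*-distribˡ-sum (A a b) (λ d → A b c * A c d))

  walks₃≡∑indeg*outdeg² : ∀ A → walks₃ A ≡ ∑[ v < n ] (indeg A v * outdeg (A ²) v)
  walks₃≡∑indeg*outdeg² A = trans (walks₃-middle A) (sum-cong-≗ λ v → begin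
    ∑[ c < n ] (indeg A v * (A v c * outdeg A c))  ≡⟨ *-distribˡ-sum (indeg A v) (λ c → A v c * outdeg A c) ⟨
    indeg A v * ∑[ c < n ] (A v c * outdeg A c)    ≡⟨ cong (indeg A v *_) (outdeg-² A v) ⟨
    indeg A v * outdeg (A ²) v                     ∎)
    where open ≡-Reasoning

  walks₃-ᵀ : ∀ A → walks₃ (A ᵀ) ≡ walks₃ A
  walks₃-ᵀ A = begin
    walks₃ (A ᵀ)                                              ≡⟨ walks₃-middle (A ᵀ) ⟩
    ∑[ b < n ] ∑[ c < n ] (outdeg A b * (A c b * indeg A c))  ≡⟨ ∑-comm (λ b c → outdeg A b * (A c b * indeg A c)) ⟩
    ∑[ c < n ] ∑[ b < n ] (outdeg A b * (A c b * indeg A c))  ≡⟨ sum-cong-≗ (λ c → sum-cong-≗ (λ b → x∙yz≈z∙yx (outdeg A b) (A c b) (indeg A c))) ⟩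
    ∑[ c < n ] ∑[ b < n ] (indeg A c * (A c b * outdeg A b))  ≡⟨ walks₃-middle A ⟨
    walks₃ A                                                  ∎
    where open ≡-Reasoning

  ∑indeg*outdeg : ∀ A → ∑[ v < n ] (indeg A v * outdeg A v) ≡ ∑[ u < n ] ∑[ w < n ] (A ²) u w
  ∑indeg*outdeg A = begin
    ∑[ v < n ] (indeg A v * outdeg A v)                ≡⟨ sum-cong-≗ (λ v → *-distribʳ-sum (outdeg A v) (λ u → A u v)) ⟩
    ∑[ v < n ] ∑[ u < n ] (A u v * outdeg A v)         ≡⟨ sum-cong-≗ (λ v → sum-cong-≗ (λ u → *-distribˡ-sum (A u v) (A v))) ⟩
    ∑[ v < n ] ∑[ u < n ] ∑[ w < n ] (A u v * A v w)   ≡⟨ ∑-comm (λ v u → ∑[ w < n ] (A u v * A v w)) ⟩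
    ∑[ u < n ] ∑[ v < n ] ∑[ w < n ] (A u v * A v w)   ≡⟨ sum-cong-≗ (λ u → ∑-comm (λ v w → A u v * A v w)) ⟩
    ∑[ u < n ] ∑[ w < n ] (A ²) u w                    ∎
    where open ≡-Reasoning

  closed₃-rotate : ∀ A v → ∑[ d < n ] (A d v * (A ²) v d) ≡ ∑[ c < n ] (A v c * (A ²) c v)
  closed₃-rotate A v = begin
    ∑[ d < n ] (A d v * (A ²) v d)                   ≡⟨ sum-cong-≗ (λ d → *-distribˡ-sum (A d v) (λ c → A v c * A c d)) ⟩
    ∑[ d < n ] ∑[ c < n ] (A d v * (A v c * A c d))  ≡⟨ ∑-comm (λ d c → A d v * (A v c * A c d)) ⟩
    ∑[ c < n ] ∑[ d < n ] (A d v * (A v c * A c d))  ≡⟨ sum-cong-≗ (λ c → sum-cong-≗ (λ d → x∙yz≈y∙zx (A d v) (A v c) (A c d))) ⟩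
    ∑[ c < n ] ∑[ d < n ] (A v c * (A c d * A d v))  ≡⟨ sum-cong-≗ (λ c → *-distribˡ-sum (A v c) (λ d → A c d * A d v)) ⟨
    ∑[ c < n ] (A v c * (A ²) c v)                   ∎
    where open ≡-Reasoning

module WalkBounds {n} (A : Matrix n) (A≤1 : ∀ u v → A u v ≤ 1) (A²+A≤1 : ∀ u w → (A ²) u w + A u w ≤ 1) where

  A²≤1 : ∀ u w → (A ²) u w ≤ 1
  A²≤1 u w = ≤-trans (m≤m+n _ _) (A²+A≤1 u w)

  outdeg²+outdeg≤n : ∀ v → outdeg (A ²) v + outdeg A v ≤ n
  outdeg²+outdeg≤n v = begin
    outdeg (A ²) v + outdeg A v         ≡⟨ ∑-distrib-+ (λ w → (A ²) v w) (A v) ⟨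
    ∑[ w < n ] ((A ²) v w + A v w)      ≤⟨ ∑-mono-≤ (A²+A≤1 v) ⟩
    ∑[ w < n ] 1                        ≡⟨ ∑-ones n ⟩
    n                                   ∎
    where open ≤-Reasoning

  -- An in-neighbour d of v that v also reaches in two steps lies on a closed 3-walk through v; such
  -- walks are determined by their first arc, since A² ≤ 1.
  outdeg²+indeg≤n+outdeg : ∀ v → outdeg (A ²) v + indeg A v ≤ n + outdeg A v
  outdeg²+indeg≤n+outdeg v = begin
    outdeg (A ²) v + indeg A v                  ≡⟨ ∑-distrib-+ (λ d → (A ²) v d) (λ d → A d v) ⟨
    ∑[ d < n ] ((A ²) v d + A d v)              ≤⟨ ∑-mono-≤ (λ d → +≤1+* (A²≤1 v d) (A≤1 d v)) ⟩
    ∑[ d < n ] (1 + A d v * (A ²) v d)          ≡⟨ ∑-distrib-+ (λ _ → 1) (λ d → A d v * (A ²) v d) ⟩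
    ∑[ d < n ] 1 + ∑[ d < n ] (A d v * (A ²) v d) ≡⟨ cong₂ _+_ (∑-ones n) (closed₃-rotate A v) ⟩
    n + ∑[ c < n ] (A v c * (A ²) c v)          ≤⟨ +-monoʳ-≤ n (∑-mono-≤ (λ c → *≤1⇒≤ (A v c) (A²≤1 c v))) ⟩
    n + outdeg A v                              ∎
    where open ≤-Reasoning

  ∑indeg*outdeg≤n² : ∑[ v < n ] (indeg A v * outdeg A v) ≤ n * n
  ∑indeg*outdeg≤n² = begin
    ∑[ v < n ] (indeg A v * outdeg A v)  ≡⟨ ∑indeg*outdeg A ⟩
    ∑[ u < n ] ∑[ w < n ] (A ²) u w      ≤⟨ ∑-mono-≤ (λ u → ∑-mono-≤ (A²≤1 u)) ⟩
    ∑[ u < n ] ∑[ w < n ] 1              ≡⟨ sum-cong-≗ {n} (λ _ → ∑-ones n) ⟩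
    ∑[ u < n ] n                         ≡⟨ ∑-const n n ⟩
    n * n                                ∎
    where open ≤-Reasoning

ᵀ-A²+A≤1 : ∀ {n} (A : Matrix n) → (∀ u w → (A ²) u w + A u w ≤ 1) → ∀ u w → ((A ᵀ) ²) u w + (A ᵀ) u w ≤ 1
ᵀ-A²+A≤1 A A²+A≤1 u w = subst (λ t → t + A w u ≤ 1) (sym (²-ᵀ A u w)) (A²+A≤1 w u)

walks₃-bound : ∀ {n} (A : Matrix n) → (∀ u v → A u v ≤ 1) → (∀ u w → (A ²) u w + A u w ≤ 1) →
               8 * walks₃ A ≤ n ^ 3 + 12 * n ^ 2
walks₃-bound {n} A A≤1 A²+A≤1 = begin
  8 * walks₃ A
    ≡⟨ eight-times (walks₃ A) ⟩
  4 * (walks₃ A + walks₃ A)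
    ≡⟨ cong (λ t → 4 * (walks₃ A + t)) (walks₃-ᵀ A) ⟨
  4 * (walks₃ A + walks₃ (A ᵀ))
    ≡⟨ cong (4 *_) (cong₂ _+_ (walks₃≡∑indeg*outdeg² A) (walks₃≡∑indeg*outdeg² (A ᵀ))) ⟩
  4 * (∑[ v < n ] (x v * s v) + ∑[ v < n ] (y v * r v))
    ≡⟨ trans (cong (4 *_) (sym (∑-distrib-+ (λ v → x v * s v) (λ v → y v * r v))))
             (*-distribˡ-sum 4 (λ v → x v * s v + y v * r v)) ⟩
  ∑[ v < n ] (4 * (x v * s v + y v * r v))
    ≤⟨ ∑-mono-≤ (λ v → vertex-bound (outdeg²+outdeg≤n v) (outdeg²+indeg≤n+outdeg v)
                                    (Aᵀ.outdeg²+outdeg≤n v) (Aᵀ.outdeg²+indeg≤n+outdeg v)) ⟩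
  ∑[ v < n ] (n * n + 12 * (x v * y v))
    ≡⟨ trans (∑-distrib-+ (λ _ → n * n) (λ v → 12 * (x v * y v)))
             (cong₂ _+_ (∑-const n (n * n)) (sym (*-distribˡ-sum 12 (λ v → x v * y v)))) ⟩
  n * (n * n) + 12 * ∑[ v < n ] (x v * y v)
    ≤⟨ +-monoʳ-≤ (n * (n * n)) (*-monoʳ-≤ 12 ∑indeg*outdeg≤n²) ⟩
  n * (n * n) + 12 * (n * n)
    ≡⟨ cong₂ (λ t u → n * (n * t) + 12 * (n * u)) (*-identityʳ n) (*-identityʳ n) ⟨
  n ^ 3 + 12 * n ^ 2
    ∎
  where
  open ≤-Reasoning
  open WalkBounds A A≤1 A²+A≤1
  eight-times : ∀ t → 8 * t ≡ 4 * (t + t)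
  eight-times = solve-∀
  module Aᵀ = WalkBounds (A ᵀ) (λ u v → A≤1 v u) (ᵀ-A²+A≤1 A A²+A≤1)
  x y s r : Fin n → ℕ
  x = indeg A
  y = outdeg A
  s = outdeg (A ²)
  r = outdeg ((A ᵀ) ²)

adjacency : ∀ {n} → Digraph n → Matrix n
adjacency G u v = 𝟙 (arc G u v)

module _ {n} {G : Digraph n} where

  walk₂ : ∀ {u c w} → Arc G u c → Arc G c w → Walk G u w 2
  walk₂ {w = w} p q = cons p (cons q (nil w))

  second-vertex : ∀ {u w} → Σ ℕ (Walk G u w) → Fin n
  second-vertex (_ , nil u)            = u
  second-vertex (_ , cons {w = c} _ _) = c

module _ {n} (G : Digraph n) where

  no-loop : ∀ {u} → ¬ Arc G u u
  no-loop {u} = subst T (irrefl G u)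

  adjacency-∧ : ∀ u c w → 𝟙 (arc G u c ∧ arc G c w) ≡ adjacency G u c * adjacency G c w
  adjacency-∧ u c w = 𝟙-∧ (arc G u c) (arc G c w)

  isP3⇒walk₃ : ∀ {a b c d} → T (isP3 G a b c d) → T (arc G a b ∧ (arc G b c ∧ arc G c d))
  isP3⇒walk₃ {a} {b} {c} {d} =
    T-∧ʳ (neq c d) ∘ T-∧ʳ (neq b d) ∘ T-∧ʳ (neq b c) ∘ T-∧ʳ (neq a d) ∘ T-∧ʳ (neq a c) ∘ T-∧ʳ (neq a b)
    where
    T-∧ʳ : ∀ x {y} → T (x ∧ y) → T y
    T-∧ʳ true t = t

  countP3≡∑ : countP3 G ≡ ∑[ a < n ] ∑[ b < n ] ∑[ c < n ] ∑[ d < n ] 𝟙 (isP3 G a b c d)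
  countP3≡∑ =
    trans (sumFin≡∑ n _) (sum-cong-≗ λ a →
    trans (sumFin≡∑ n _) (sum-cong-≗ λ b →
    trans (sumFin≡∑ n _) (sum-cong-≗ λ c →
    sumFin≡∑ n (λ d → 𝟙 (isP3 G a b c d)))))

  𝟙-walk₃ : ∀ a b c d → 𝟙 (arc G a b ∧ (arc G b c ∧ arc G c d)) ≡ adjacency G a b * (adjacency G b c * adjacency G c d)
  𝟙-walk₃ a b c d = trans (𝟙-∧ (arc G a b) _) (cong (adjacency G a b *_) (adjacency-∧ b c d))

  countP3≤walks₃ : countP3 G ≤ walks₃ (adjacency G)
  countP3≤walks₃ rewrite countP3≡∑ =
    ∑-mono-≤ λ a → ∑-mono-≤ λ b → ∑-mono-≤ λ c → ∑-mono-≤ λ d →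
      ≤-trans (𝟙-mono isP3⇒walk₃) (≤-reflexive (𝟙-walk₃ a b c d))

module Geodetic₂ {n} {G : Digraph n} (geo : Geodetic 2 G) where

  no-digon : ∀ {u w} → Arc G u w → ¬ Arc G w u
  no-digon {u} p q with () ← cong proj₁ (geo u u 0 2 (nil u) (walk₂ p q) z≤n ≤-refl)

  no-shortcut : ∀ {u c w} → Arc G u c → Arc G c w → ¬ Arc G u w
  no-shortcut {u} {w = w} p q r with () ← cong proj₁ (geo u w 1 2 (cons r (nil w)) (walk₂ p q) (s≤s z≤n) ≤-refl)

  unique-midpoint : ∀ {u c c′ w} → Arc G u c → Arc G c w → Arc G u c′ → Arc G c′ w → c ≡ c′
  unique-midpoint p q p′ q′ = cong second-vertex (geo _ _ 2 2 (walk₂ p q) (walk₂ p′ q′) ≤-refl ≤-refl)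

  private
    A = adjacency G

  A²≤1 : ∀ u w → (A ²) u w ≤ 1
  A²≤1 u w = ∑-≤1 (λ c → A u c * A c w) (λ c → *-mono-≤ (𝟙≤1 (arc G u c)) (𝟙≤1 (arc G c w)))
    λ c c′ p p′ → unique-midpoint (first p) (second p) (first p′) (second p′)
    where
    first : ∀ {c} → A u c * A c w ≡ 1 → Arc G u c
    first {c} p = 𝟙≡1⇒T (m*n≡1⇒m≡1 (A u c) (A c w) p)
    second : ∀ {c} → A u c * A c w ≡ 1 → Arc G c w
    second {c} p = 𝟙≡1⇒T (m*n≡1⇒n≡1 (A u c) (A c w) p)

  A²+A≤1 : ∀ u w → (A ²) u w + A u w ≤ 1
  A²+A≤1 u w with arc G u w in uw
  ... | false = ≤-trans (≤-reflexive (+-identityʳ _)) (A²≤1 u w)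
  ... | true  = +-monoˡ-≤ 1 (≤-trans (∑-mono-≤ no-two-step) (≤-reflexive (trans (∑-const n 0) (*-zeroʳ n))))
    where
    no-two-step : ∀ c → A u c * A c w ≤ 0
    no-two-step c = ≤-trans (≤-reflexive (sym (adjacency-∧ G u c w)))
      (𝟙-mono λ t → let uc , cw = Equivalence.to T-∧ t in no-shortcut uc cw (subst T (sym uw) _))

  module _ (no-triangle : ∀ {a b c} → Arc G a b → Arc G b c → ¬ Arc G c a) where

    walk₃⇒isP3 : ∀ {a b c d} → Arc G a b → Arc G b c → Arc G c d → T (isP3 G a b c d)
    walk₃⇒isP3 {a} {b} {c} {d} ab bc cd =
      both (neq a b) (distinct λ { refl → no-loop G ab }) $
      both (neq a c) (distinct λ { refl → no-digon ab bc }) $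
      both (neq a d) (distinct λ { refl → no-triangle ab bc cd }) $
      both (neq b c) (distinct λ { refl → no-loop G bc }) $
      both (neq b d) (distinct λ { refl → no-digon bc cd }) $
      both (neq c d) (distinct λ { refl → no-loop G cd }) $
      both (arc G a b) ab $ both (arc G b c) bc cd
      where
      both : ∀ x {y} → T x → T y → T (x ∧ y)
      both true _ q = q
      distinct : ∀ {x y : Fin n} → x ≢ y → T (neq x y)
      distinct = fromWitnessFalse

    walks₃≤countP3 : walks₃ A ≤ countP3 G
    walks₃≤countP3 rewrite countP3≡∑ G =
      ∑-mono-≤ λ a → ∑-mono-≤ λ b → ∑-mono-≤ λ c → ∑-mono-≤ λ d →
        ≤-trans (≤-reflexive (sym (𝟙-walk₃ G a b c d)))
                (𝟙-mono λ t → let ab , t′ = Equivalence.to T-∧ t ; bc , cd = Equivalence.to T-∧ t′ in walk₃⇒isP3 ab bc cd)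

geodetic₂-intro : ∀ {n} {G : Digraph n} →
                  (∀ {u w} → Arc G u w → ¬ Arc G w u) →
                  (∀ {u c w} → Arc G u c → Arc G c w → ¬ Arc G u w) →
                  (∀ {u c c′ w} → Arc G u c → Arc G c w → Arc G u c′ → Arc G c′ w → c ≡ c′) →
                  Geodetic 2 G
geodetic₂-intro {G = G} no-digon no-shortcut unique-midpoint = same-walk
  where
  same-walk : Geodetic 2 G
  same-walk _ _ _ _ (nil _) (nil _) _ _ = refl
  same-walk _ _ _ _ (nil _) (cons p (nil _)) _ _ = ⊥-elim (no-loop G p)
  same-walk _ _ _ _ (cons p (nil _)) (nil _) _ _ = ⊥-elim (no-loop G p)
  same-walk _ _ _ _ (nil _) (cons p (cons q (nil _))) _ _ = ⊥-elim (no-digon p q)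
  same-walk _ _ _ _ (cons p (cons q (nil _))) (nil _) _ _ = ⊥-elim (no-digon p q)
  same-walk _ _ _ _ (cons r (nil _)) (cons p (cons q (nil _))) _ _ = ⊥-elim (no-shortcut p q r)
  same-walk _ _ _ _ (cons p (cons q (nil _))) (cons r (nil _)) _ _ = ⊥-elim (no-shortcut p q r)
  same-walk _ _ _ _ (cons p (nil _)) (cons p′ (nil _)) _ _ with refl ← T-irrelevant p p′ = refl
  same-walk _ _ _ _ (cons p (cons q (nil _))) (cons p′ (cons q′ (nil _))) _ _
    with refl ← unique-midpoint p q p′ q′
    with refl ← T-irrelevant p p′ | refl ← T-irrelevant q q′ = refl
  same-walk _ _ _ _ (cons _ (cons _ (cons _ _))) _ (s≤s (s≤s ())) _
  same-walk _ _ _ _ _ (cons _ (cons _ (cons _ _))) _ (s≤s (s≤s ()))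

T-≢ : ∀ {x y} → T x → T (not y) → x ≢ y
T-≢ {true} {false} _ _ ()

no-three-distinct-Bools : ∀ {x y z : Bool} → x ≢ y → y ≢ z → x ≢ z → ⊥
no-three-distinct-Bools {false} {false} x≢y _ _ = x≢y refl
no-three-distinct-Bools {true}  {true}  x≢y _ _ = x≢y refl
no-three-distinct-Bools {false} {true} {true}  _ y≢z _ = y≢z refl
no-three-distinct-Bools {true} {false} {false} _ y≢z _ = y≢z refl
no-three-distinct-Bools {false} {true} {false} _ _ x≢z = x≢z refl
no-three-distinct-Bools {true} {false} {true}  _ _ x≢z = x≢z refl

-- The extremal digraph

module Construction (n k : ℕ) (k+k≤n : k + k ≤ n) where

  Step : ℕ → ℕ → Set
  Step i j = (i < k × k ≤ j × j < k + k × j ≢ i + k) ⊎ (j < k × i ≡ j + k)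

  step? : ∀ i j → Dec (Step i j)
  step? i j = (i <? k ×-dec k ≤? j ×-dec j <? k + k ×-dec ¬? (j ≟ i + k)) ⊎-dec (j <? k ×-dec i ≟ j + k)

  below : ℕ → Bool
  below i = ⌊ i <? k ⌋

  step-crosses : ∀ {i j} → Step i j → below i ≢ below j
  step-crosses (inj₁ (i<k , k≤j , _)) = T-≢ (fromWitness i<k) (fromWitnessFalse (≤⇒≯ k≤j))
  step-crosses (inj₂ (j<k , refl))     = ≢-sym (T-≢ (fromWitness j<k) (fromWitnessFalse (≤⇒≯ (m≤n+m k _))))

  step-irrefl : ∀ {i} → ¬ Step i i
  step-irrefl s = step-crosses s refl

  step-no-digon : ∀ {i j} → Step i j → ¬ Step j i
  step-no-digon (inj₁ (i<k , k≤j , _)) (inj₁ (j<k , _))      = <⇒≱ j<k k≤j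
  step-no-digon (inj₁ (_ , _ , _ , j≢i+k)) (inj₂ (_ , j≡i+k)) = j≢i+k j≡i+k
  step-no-digon (inj₂ (_ , i≡j+k)) (inj₁ (_ , _ , _ , i≢j+k)) = i≢j+k i≡j+k
  step-no-digon (inj₂ (j<k , refl)) (inj₂ (i<k , _))          = <⇒≱ i<k (m≤n+m k _)

  step-unique-midpoint : ∀ {i w w′ j} → Step i w → Step w j → Step i w′ → Step w′ j → w ≡ w′
  step-unique-midpoint (inj₂ (_ , i≡w+k)) _ (inj₂ (_ , i≡w′+k)) _ = +-cancelʳ-≡ k _ _ (trans (sym i≡w+k) i≡w′+k)
  step-unique-midpoint (inj₂ (_ , refl)) _ (inj₁ (w+k<k , _)) _ = ⊥-elim (<⇒≱ w+k<k (m≤n+m k _))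
  step-unique-midpoint (inj₁ (i<k , _)) _ (inj₂ (_ , refl)) _ = ⊥-elim (<⇒≱ i<k (m≤n+m k _))
  step-unique-midpoint (inj₁ (_ , k≤w , _)) (inj₁ (w<k , _)) _ _ = ⊥-elim (<⇒≱ w<k k≤w)
  step-unique-midpoint (inj₁ _) _ (inj₁ (_ , k≤w′ , _)) (inj₁ (w′<k , _)) = ⊥-elim (<⇒≱ w′<k k≤w′)
  step-unique-midpoint (inj₁ _) (inj₂ (_ , w≡j+k)) (inj₁ _) (inj₂ (_ , w′≡j+k)) = trans w≡j+k (sym w′≡j+k)

  G : Digraph n
  arc G u v = ⌊ step? (toℕ u) (toℕ v) ⌋
  irrefl G v with step? (toℕ v) (toℕ v)
  ... | yes s = ⊥-elim (step-irrefl s)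
  ... | no _  = refl

  no-triangle : ∀ {a b c} → Arc G a b → Arc G b c → ¬ Arc G c a
  no-triangle ab bc ca =
    no-three-distinct-Bools (step-crosses (toWitness ab)) (step-crosses (toWitness bc)) (≢-sym (step-crosses (toWitness ca)))

  geodetic : Geodetic 2 G
  geodetic = geodetic₂-intro
    (λ p q → step-no-digon (toWitness p) (toWitness q))
    (λ p q r → no-three-distinct-Bools (step-crosses (toWitness p)) (step-crosses (toWitness q)) (step-crosses (toWitness r)))
    (λ p q p′ q′ → Fin.toℕ-injective (step-unique-midpoint (toWitness p) (toWitness q) (toWitness p′) (toWitness q′)))

  private
    A = adjacency G

  arc-of-step : ∀ {u v} → Step (toℕ u) (toℕ v) → 1 ≤ A u v
  arc-of-step s = T⇒1≤𝟙 (fromWitness s)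

  down : Fin n → Fin n
  down b = fromℕ< (≤-<-trans (m∸n≤m (toℕ b) k) (Fin.toℕ<n b))

  down+k : ∀ b → k ≤ toℕ b → toℕ b ≡ toℕ (down b) + k
  down+k b k≤b = sym (trans (cong (_+ k) (Fin.toℕ-fromℕ< _)) (m∸n+n≡m k≤b))

  down<k : ∀ b → k ≤ toℕ b → toℕ b < k + k → toℕ (down b) < k
  down<k b k≤b b<k+k = +-cancelʳ-< k _ _ (subst (_< k + k) (down+k b k≤b) b<k+k)

  step-down : ∀ b → k ≤ toℕ b → toℕ b < k + k → Step (toℕ b) (toℕ (down b))
  step-down b k≤b b<k+k = inj₂ (down<k b k≤b b<k+k , down+k b k≤b)

  k∸1≤indeg : ∀ b → k ≤ toℕ b → toℕ b < k + k → k ∸ 1 ≤ indeg A b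
  k∸1≤indeg b k≤b b<k+k = ∑-interval-except (λ a → A a b) 0 k (toℕ b ∸ k) (≤-trans (m≤m+n k k) k+k≤n)
    λ a _ a<k a≢b∸k → arc-of-step (inj₁ (a<k , k≤b , b<k+k , λ b≡a+k → a≢b∸k (sym (trans (cong (_∸ k) b≡a+k) (m+n∸n≡m _ k)))))

  k∸1≤outdeg : ∀ c → toℕ c < k → k ∸ 1 ≤ outdeg A c
  k∸1≤outdeg c c<k = ∑-interval-except (A c) k k (toℕ c + k) k+k≤n
    λ d k≤d d<k+k d≢c+k → arc-of-step (inj₁ (c<k , k≤d , d<k+k , d≢c+k))

  walks₃-lower : k * ((k ∸ 1) * (k ∸ 1)) ≤ walks₃ A
  walks₃-lower = begin
    k * ((k ∸ 1) * (k ∸ 1))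
      ≤⟨ ∑-interval (λ b → ∑[ c < n ] (indeg A b * (A b c * outdeg A c))) k k _ k+k≤n through-down ⟩
    ∑[ b < n ] ∑[ c < n ] (indeg A b * (A b c * outdeg A c))
      ≡⟨ walks₃-middle A ⟨
    walks₃ A
      ∎
    where
    open ≤-Reasoning
    through-down : ∀ b → k ≤ toℕ b → toℕ b < k + k →
                   (k ∸ 1) * (k ∸ 1) ≤ ∑[ c < n ] (indeg A b * (A b c * outdeg A c))
    through-down b k≤b b<k+k = begin
      (k ∸ 1) * (k ∸ 1)                                      ≡⟨ cong ((k ∸ 1) *_) (*-identityˡ (k ∸ 1)) ⟨
      (k ∸ 1) * (1 * (k ∸ 1))                                ≤⟨ *-mono-≤ (k∸1≤indeg b k≤b b<k+k)
                                                                 (*-mono-≤ (arc-of-step (step-down b k≤b b<k+k)) (k∸1≤outdeg c (down<k b k≤b b<k+k))) ⟩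
      indeg A b * (A b c * outdeg A c)                       ≤⟨ term≤∑ (λ c → indeg A b * (A b c * outdeg A c)) c ⟩
      ∑[ c < n ] (indeg A b * (A b c * outdeg A c))          ∎
      where
      c = down b

  countP3-lower : k * ((k ∸ 1) * (k ∸ 1)) ≤ countP3 G
  countP3-lower = ≤-trans walks₃-lower (Geodetic₂.walks₃≤countP3 geodetic no-triangle)

cube-bound : ∀ {n k} → k + k ≤ n → n ≤ suc (k + k) → n ^ 3 ≤ 8 * (k * ((k ∸ 1) * (k ∸ 1))) + 12 * n ^ 2
cube-bound {zero}        {zero} _ _        = z≤n
cube-bound {suc zero}    {zero} _ _        = s≤s z≤n
cube-bound {suc (suc _)} {zero} _ (s≤s ())
cube-bound {n} {suc j} k+k≤n n≤1+k+k = begin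
  n ^ 3                                                   ≤⟨ ^-monoˡ-≤ 3 n≤1+k+k ⟩
  suc (suc j + suc j) ^ 3                                 ≤⟨ m≤m+n _ _ ⟩
  suc (suc j + suc j) ^ 3 + (20 * (j * j) + 42 * j + 21)  ≡⟨ expand j ⟩
  8 * (suc j * (j * j)) + 12 * (suc j + suc j) ^ 2        ≤⟨ +-monoʳ-≤ _ (*-monoʳ-≤ 12 (^-monoˡ-≤ 2 k+k≤n)) ⟩
  8 * (suc j * (j * j)) + 12 * n ^ 2                      ∎
  where
  open ≤-Reasoning
  open +-*-Solver using (con; _:+_; _:*_; _:^_; _:=_)
  expand : ∀ j → suc (suc j + suc j) ^ 3 + (20 * (j * j) + 42 * j + 21) ≡ 8 * (suc j * (j * j)) + 12 * (suc j + suc j) ^ 2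
  expand = +-*-Solver.solve 1 (λ j → (con 1 :+ ((con 1 :+ j) :+ (con 1 :+ j))) :^ 3 :+ (con 20 :* (j :* j) :+ con 42 :* j :+ con 21)
                       := con 8 :* ((con 1 :+ j) :* (j :* j)) :+ con 12 :* ((con 1 :+ j) :+ (con 1 :+ j)) :^ 2) refl

⌊n/2⌋+⌊n/2⌋≤n : ∀ n → ⌊ n /2⌋ + ⌊ n /2⌋ ≤ n
⌊n/2⌋+⌊n/2⌋≤n n = subst (⌊ n /2⌋ + ⌊ n /2⌋ ≤_) (⌊n/2⌋+⌈n/2⌉≡n n) (+-monoʳ-≤ ⌊ n /2⌋ (⌊n/2⌋≤⌈n/2⌉ n))

n≤1+⌊n/2⌋+⌊n/2⌋ : ∀ n → n ≤ suc (⌊ n /2⌋ + ⌊ n /2⌋)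
n≤1+⌊n/2⌋+⌊n/2⌋ n = begin
  n                        ≡⟨ ⌊n/2⌋+⌈n/2⌉≡n n ⟨
  ⌊ n /2⌋ + ⌈ n /2⌉        ≤⟨ +-monoʳ-≤ ⌊ n /2⌋ (⌊n/2⌋-mono (n≤1+n (suc n))) ⟩
  ⌊ n /2⌋ + suc ⌊ n /2⌋    ≡⟨ +-suc ⌊ n /2⌋ ⌊ n /2⌋ ⟩
  suc (⌊ n /2⌋ + ⌊ n /2⌋)  ∎
  where open ≤-Reasoning

theorem32 : Σ ℕ λ C → Σ ℕ λ N → (n : ℕ) → N ≤ n →
    ((G : Digraph n) → Geodetic 2 G → 8 * countP3 G ≤ n ^ 3 + C * n ^ 2)
    × (Σ (Digraph n) λ G → Geodetic 2 G × (n ^ 3 ≤ 8 * countP3 G + C * n ^ 2))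
theorem32 = 12 , 0 , λ n _ → upper n , lower n
  where
  upper : ∀ n (G : Digraph n) → Geodetic 2 G → 8 * countP3 G ≤ n ^ 3 + 12 * n ^ 2
  upper n G geo = ≤-trans (*-monoʳ-≤ 8 (countP3≤walks₃ G))
                          (walks₃-bound (adjacency G) (λ u v → 𝟙≤1 (arc G u v)) (Geodetic₂.A²+A≤1 geo))

  lower : ∀ n → Σ (Digraph n) λ G → Geodetic 2 G × (n ^ 3 ≤ 8 * countP3 G + 12 * n ^ 2)
  lower n = G , geodetic ,
            ≤-trans (cube-bound {k = ⌊ n /2⌋} (⌊n/2⌋+⌊n/2⌋≤n n) (n≤1+⌊n/2⌋+⌊n/2⌋ n)) (+-monoˡ-≤ (12 * n ^ 2) (*-monoʳ-≤ 8 countP3-lower))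
    where open Construction n ⌊ n /2⌋ (⌊n/2⌋+⌊n/2⌋≤n n)
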